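{- Let $D$ be a connected digraph. The following are equivalent: (i) $\langle D\rangle$ is a rectangular band; (ii) $\langle D\rangle$ is simple; (iii) $\langle D\rangle$ is a left zero semigroup or a right zero semigroup.
   Context: For $a\neq b$ in $\{1,\ldots,n\}$, $(a\to b)$ denotes the transformation mapping $a$ to $b$ and fixing every other point; transformations are composed left to right. For a digraph $D$ on $\{1,\ldots,n\}$ (no loops, no multiple arcs), $\langle D\rangle$ is the semigroup generated by all $(a\to b)$ with $(a,b)$ an arc. Connected means the underlying undirected graph is connected. A semigroup is simple if it has a single $\mathscr{J}$-class. A left (right) zero semigroup satisfies $ab=a$ ($ab=b$) for all $a,b$. -}

module Defs where

open import Data.Nat using (ℕ)
open import Data.Fin using (Fin; _≟_)
open import Data.Bool using (Bool; true; false)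
open import Data.Product using (Σ; ∃; _×_; _,_)
open import Data.Sum using (_⊎_)
open import Relation.Nullary using (yes; no; ¬_)
open import Relation.Binary.PropositionalEquality using (_≡_)

Trans : ℕ → Set
Trans n = Fin n → Fin n

_≈_ : ∀ {n} → Trans n → Trans n → Set
f ≈ g = ∀ x → f x ≡ g x

-- Left-to-right composition: x (f ⨟ g) = (x f) g.
_⨟_ : ∀ {n} → Trans n → Trans n → Trans n
(f ⨟ g) x = g (f x)

infixl 7 _⨟_
infix 4 _≈_

arcT : ∀ {n} → Fin n → Fin n → Trans n
arcT a b x with x ≟ a
... | yes _ = b
... | no _  = x

record Digraph (n : ℕ) : Set where
  field
    arc    : Fin n → Fin n → Bool
    noLoop : ∀ a → arc a a ≡ false
open Digraph public

data Linked {n} (D : Digraph n) : Fin n → Fin n → Set where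
  here : ∀ {a} → Linked D a a
  fwd  : ∀ {a b c} → arc D a b ≡ true → Linked D b c → Linked D a c
  bwd  : ∀ {a b c} → arc D b a ≡ true → Linked D b c → Linked D a c

Connected : ∀ {n} → Digraph n → Set
Connected D = ∀ a b → Linked D a b

data InGen {n} (D : Digraph n) : Trans n → Set where
  gen  : ∀ {a b f} → arc D a b ≡ true → f ≈ arcT a b → InGen D f
  mul  : ∀ {f g h} → InGen D f → InGen D g → h ≈ f ⨟ g → InGen D h

InGen¹ : ∀ {n} → Digraph n → Trans n → Set
InGen¹ D f = InGen D f ⊎ (∀ x → f x ≡ x)

J-rel : ∀ {n} → Digraph n → Trans n → Trans n → Set
J-rel D f g =
  (Σ (Trans _) λ x → Σ (Trans _) λ y → InGen¹ D x × InGen¹ D y × f ≈ x ⨟ g ⨟ y) ×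
  (Σ (Trans _) λ x → Σ (Trans _) λ y → InGen¹ D x × InGen¹ D y × g ≈ x ⨟ f ⨟ y)

IsSimple : ∀ {n} → Digraph n → Set
IsSimple D = (Σ (Trans _) λ f → InGen D f) ×
             (∀ f g → InGen D f → InGen D g → J-rel D f g)

IsRectangularBand : ∀ {n} → Digraph n → Set
IsRectangularBand D =
  (∀ f → InGen D f → f ⨟ f ≈ f) ×
  (∀ f g → InGen D f → InGen D g → f ⨟ g ⨟ f ≈ f)

IsLeftZero : ∀ {n} → Digraph n → Set
IsLeftZero D = ∀ f g → InGen D f → InGen D g → f ⨟ g ≈ f

IsRightZero : ∀ {n} → Digraph n → Set
IsRightZero D = ∀ f g → InGen D f → InGen D g → f ⨟ g ≈ g

module Submission where

-- Left/right zero ⇒ rectangular band ⇒ simple is pure semigroup theory.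
-- The content is simple ⇒ left or right zero.  The key counting fact is that
-- (a→b) has image of size n-1 while (a→b)(c→d) misses both a and c, so for
-- arcs (a,b), (c,d) with a ≠ c and d ≠ a the former cannot lie in
-- S¹ (a→b)(c→d) S¹; hence in a simple ⟨D⟩ two arcs with distinct sources
-- form a 2-cycle.  A 2-cycle {a,b} is then closed under all arcs, so by
-- connectivity it contains every vertex, impossible when n ≥ 3.  Thus for
-- n ≥ 3 all arcs share one source a₀; elements of ⟨D⟩ then fix every point
-- but a₀ and never hit a₀, which makes ⟨D⟩ left zero.  For n = 2 every
-- element of ⟨D⟩ is constant, so ⟨D⟩ is right zero.

open import Defs
open import Data.Nat using (ℕ; zero; suc; _≥_; s≤s; z≤n)
open import Data.Nat.Properties using (1+n≰n)
open import Data.Fin using (Fin; zero; suc; punchIn; punchOut; _≟_)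
open import Data.Fin.Properties
  using (injective⇒≤; punchOut-injective; punchIn-injective; punchInᵢ≢i; any?)
open import Data.Bool using (true)
import Data.Bool.Properties as Bool
open import Data.Sum using (_⊎_; inj₁; inj₂)
open import Data.Product using (_×_; _,_; Σ; ∃₂; proj₁; proj₂)
open import Data.Empty using (⊥; ⊥-elim)
open import Function.Bundles using (_⇔_; mk⇔)
open import Function.Definitions using (Injective)
open import Relation.Nullary using (¬_; yes; no)
open import Relation.Nullary.Decidable using (_×-dec_; ¬?)
open import Relation.Binary.PropositionalEquality
  using (_≡_; _≢_; refl; sym; trans; cong; module ≡-Reasoning)

-- An injection Fin (m+1) → Fin (m+2) misses at most one point: otherwise
-- removing two missed points gives an injection Fin (m+1) → Fin m.
injection-misses-at-most-one : ∀ {m} {p q : Fin (suc (suc m))} → p ≢ q →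
  (w : Fin (suc m) → Fin (suc (suc m))) → Injective _≡_ _≡_ w →
  (∀ i → w i ≢ p) → (∀ i → w i ≢ q) → ⊥
injection-misses-at-most-one {m} {p} {q} p≢q w w-inj w≢p w≢q =
  1+n≰n (injective⇒≤ w″-inj)
  where
  p≢w : ∀ i → p ≢ w i
  p≢w i e = w≢p i (sym e)
  w′ : Fin (suc m) → Fin (suc m)
  w′ i = punchOut (p≢w i)
  q′≢w′ : ∀ i → punchOut p≢q ≢ w′ i
  q′≢w′ i e = w≢q i (sym (punchOut-injective p≢q (p≢w i) e))
  w″ : Fin (suc m) → Fin m
  w″ i = punchOut (q′≢w′ i)
  w″-inj : Injective _≡_ _≡_ w″
  w″-inj {i} {j} e =
    w-inj (punchOut-injective (p≢w i) (p≢w j) (punchOut-injective (q′≢w′ i) (q′≢w′ j) e))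

-- A self-map of Fin n having a left inverse away from one point r is injective
-- on n-1 points, so it cannot miss two distinct points p and q.
retract-off-one-misses-one : ∀ {n} (r p q : Fin n) → p ≢ q → (φ ψ : Fin n → Fin n) →
  (∀ z → z ≢ r → ψ (φ z) ≡ z) → (∀ z → φ z ≢ p) → (∀ z → φ z ≢ q) → ⊥
retract-off-one-misses-one {suc zero} r zero zero p≢q _ _ _ _ _ = p≢q refl
retract-off-one-misses-one {suc (suc m)} r p q p≢q φ ψ left-inv φ≢p φ≢q =
  injection-misses-at-most-one p≢q (λ i → φ (punchIn r i)) φ∘punchIn-injective
    (λ i → φ≢p (punchIn r i)) (λ i → φ≢q (punchIn r i))
  where
  φ∘punchIn-injective : Injective _≡_ _≡_ (λ i → φ (punchIn r i))
  φ∘punchIn-injective {i} {j} e = punchIn-injective r i j (begin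
    punchIn r i             ≡⟨ sym (left-inv (punchIn r i) (punchInᵢ≢i r i)) ⟩
    ψ (φ (punchIn r i))     ≡⟨ cong ψ e ⟩
    ψ (φ (punchIn r j))     ≡⟨ left-inv (punchIn r j) (punchInᵢ≢i r j) ⟩
    punchIn r j             ∎)
    where open ≡-Reasoning

arcT-hit-≢ : ∀ {n} {a b : Fin n} (x : Fin n) → a ≢ b → arcT a b x ≢ a
arcT-hit-≢ {a = a} x a≢b e with x ≟ a
... | yes _   = a≢b (sym e)
... | no  x≢a = x≢a e

arcT-fix : ∀ {n} {a b : Fin n} (x : Fin n) → x ≢ a → arcT a b x ≡ x
arcT-fix {a = a} x x≢a with x ≟ a
... | yes e = ⊥-elim (x≢a e)
... | no  _ = refl

arcT-avoid : ∀ {n} {c d : Fin n} (x y : Fin n) → x ≢ y → d ≢ y → arcT c d x ≢ y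
arcT-avoid {c = c} x y x≢y d≢y with x ≟ c
... | yes _ = d≢y
... | no  _ = x≢y

arc-irreflexive : ∀ {n} (D : Digraph n) {a b} → arc D a b ≡ true → a ≢ b
arc-irreflexive D {a} ab refl with trans (sym ab) (noLoop D a)
... | ()

-- (a → b) does not lie in S¹ (a→b)(c→d) S¹ for any transformations x, y:
-- x(a→b)(c→d) misses a and c, yet y must invert it on all points ≠ a.
arcT-not-below-product : ∀ {n} {a b c d : Fin n} → a ≢ b → c ≢ d → a ≢ c → d ≢ a →
  (x y : Trans n) → ¬ (arcT a b ≈ x ⨟ (arcT a b ⨟ arcT c d) ⨟ y)
arcT-not-below-product {a = a} {b} {c} {d} a≢b c≢d a≢c d≢a x y eq =
  retract-off-one-misses-one a a c a≢c φ y left-inv φ≢a φ≢c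
  where
  φ : Trans _
  φ = x ⨟ (arcT a b ⨟ arcT c d)
  left-inv : ∀ z → z ≢ a → y (φ z) ≡ z
  left-inv z z≢a = trans (sym (eq z)) (arcT-fix z z≢a)
  φ≢a : ∀ z → φ z ≢ a
  φ≢a z = arcT-avoid (arcT a b (x z)) a (arcT-hit-≢ (x z) a≢b) d≢a
  φ≢c : ∀ z → φ z ≢ c
  φ≢c z = arcT-hit-≢ (arcT a b (x z)) c≢d

simple-separates : ∀ {n} (D : Digraph n) → IsSimple D → ∀ {a b c d} →
  arc D a b ≡ true → arc D c d ≡ true → a ≢ c → d ≢ a → ⊥
simple-separates D (_ , J) {a} {b} {c} {d} ab cd a≢c d≢a
  with proj₁ (J (arcT a b) (arcT a b ⨟ arcT c d) (gen ab (λ _ → refl))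
                (mul (gen ab (λ _ → refl)) (gen cd (λ _ → refl)) (λ _ → refl)))
... | x , y , _ , _ , eq =
  arcT-not-below-product (arc-irreflexive D ab) (arc-irreflexive D cd) a≢c d≢a x y eq

simple-two-cycle : ∀ {n} (D : Digraph n) → IsSimple D → ∀ {a b c d} →
  arc D a b ≡ true → arc D c d ≡ true → a ≢ c → d ≡ a × b ≡ c
simple-two-cycle D S {a} {b} {c} {d} ab cd a≢c with d ≟ a
... | no  d≢a = ⊥-elim (simple-separates D S ab cd a≢c d≢a)
... | yes refl with b ≟ c
...   | yes b≡c = refl , b≡c
...   | no  b≢c = ⊥-elim (simple-separates D S cd ab (λ e → a≢c (sym e)) b≢c)

linked-closed : ∀ {n} (D : Digraph n) (P : Fin n → Set) →
  (∀ {u v} → arc D u v ≡ true → P u → P v) →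
  (∀ {u v} → arc D u v ≡ true → P v → P u) →
  ∀ {x y} → Linked D x y → P x → P y
linked-closed D P fwd-closed bwd-closed here          px = px
linked-closed D P fwd-closed bwd-closed (fwd arc′ xy) px =
  linked-closed D P fwd-closed bwd-closed xy (fwd-closed arc′ px)
linked-closed D P fwd-closed bwd-closed (bwd arc′ xy) px =
  linked-closed D P fwd-closed bwd-closed xy (bwd-closed arc′ px)

connected-has-arc : ∀ {n} (D : Digraph n) → Connected D → {a b : Fin n} → a ≢ b →
  Σ (Fin n) λ u → Σ (Fin n) λ v → arc D u v ≡ true
connected-has-arc D conn {a} {b} a≢b with conn a b
... | here             = ⊥-elim (a≢b refl)
... | fwd {b = v} av _ = a , v , av
... | bwd {b = v} va _ = v , a , va

InPair : ∀ {n} → Fin n → Fin n → Fin n → Set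
InPair a b x = x ≡ a ⊎ x ≡ b

outside-pair : ∀ {k} (a b : Fin (suc (suc (suc k)))) →
  Σ (Fin (suc (suc (suc k)))) λ e → ¬ InPair a b e
outside-pair zero          zero          = suc zero       , λ { (inj₁ ()) ; (inj₂ ()) }
outside-pair zero          (suc zero)    = suc (suc zero) , λ { (inj₁ ()) ; (inj₂ ()) }
outside-pair zero          (suc (suc _)) = suc zero       , λ { (inj₁ ()) ; (inj₂ ()) }
outside-pair (suc zero)    zero          = suc (suc zero) , λ { (inj₁ ()) ; (inj₂ ()) }
outside-pair (suc zero)    (suc _)       = zero           , λ { (inj₁ ()) ; (inj₂ ()) }
outside-pair (suc (suc _)) zero          = suc zero       , λ { (inj₁ ()) ; (inj₂ ()) }
outside-pair (suc (suc _)) (suc _)       = zero           , λ { (inj₁ ()) ; (inj₂ ()) }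

-- In a simple ⟨D⟩, a 2-cycle {a, b} is closed along arcs: any arc leaving or
-- entering it has a different source from one of the cycle arcs.
two-cycle-closed-out : ∀ {n} (D : Digraph n) → IsSimple D → ∀ {a b} →
  arc D a b ≡ true → arc D b a ≡ true →
  ∀ {u v} → arc D u v ≡ true → InPair a b u → InPair a b v
two-cycle-closed-out D S ab ba uv (inj₁ refl) =
  inj₂ (proj₂ (simple-two-cycle D S uv ba (arc-irreflexive D ab)))
two-cycle-closed-out D S ab ba uv (inj₂ refl) =
  inj₁ (proj₂ (simple-two-cycle D S uv ab (arc-irreflexive D ba)))

two-cycle-closed-in : ∀ {n} (D : Digraph n) → IsSimple D → ∀ {a b} →
  arc D a b ≡ true → arc D b a ≡ true →
  ∀ {u v} → arc D u v ≡ true → InPair a b v → InPair a b u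
two-cycle-closed-in D S ab ba uv (inj₁ refl) =
  inj₂ (sym (proj₁ (simple-two-cycle D S uv ab (arc-irreflexive D uv))))
two-cycle-closed-in D S ab ba uv (inj₂ refl) =
  inj₁ (sym (proj₁ (simple-two-cycle D S uv ba (arc-irreflexive D uv))))

simple-no-two-cycle : ∀ {k} (D : Digraph (suc (suc (suc k)))) → Connected D → IsSimple D →
  ∀ {a b} → arc D a b ≡ true → arc D b a ≡ true → ⊥
simple-no-two-cycle D conn S {a} {b} ab ba =
  e∉ab (linked-closed D (InPair a b) (two-cycle-closed-out D S ab ba)
          (two-cycle-closed-in D S ab ba) (conn a e) (inj₁ refl))
  where
  e   = proj₁ (outside-pair a b)
  e∉ab = proj₂ (outside-pair a b)

sources-at-or-elsewhere : ∀ {n} (D : Digraph n) (a₀ : Fin n) →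
  (∀ c d → arc D c d ≡ true → c ≡ a₀) ⊎ ∃₂ λ c d → arc D c d ≡ true × c ≢ a₀
sources-at-or-elsewhere D a₀
  with any? (λ c → any? (λ d → (arc D c d Bool.≟ true) ×-dec ¬? (c ≟ a₀)))
... | yes (c , d , cd , c≢a₀) = inj₂ (c , d , cd , c≢a₀)
... | no  none = inj₁ source-a₀
  where
  source-a₀ : ∀ c d → arc D c d ≡ true → c ≡ a₀
  source-a₀ c d cd with c ≟ a₀
  ... | yes c≡a₀ = c≡a₀
  ... | no  c≢a₀ = ⊥-elim (none (c , d , cd , c≢a₀))

-- If all arcs leave a₀, every element of ⟨D⟩ fixes all points ≠ a₀ and never
-- takes the value a₀; such transformations form a left zero semigroup.
module OutStar {n} (D : Digraph n) (a₀ : Fin n)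
               (source-a₀ : ∀ c d → arc D c d ≡ true → c ≡ a₀) where

  FixesOffAndAvoids : Trans n → Set
  FixesOffAndAvoids f = (∀ y → y ≢ a₀ → f y ≡ y) × (∀ x → f x ≢ a₀)

  generated-fixes-and-avoids : ∀ {f} → InGen D f → FixesOffAndAvoids f
  generated-fixes-and-avoids (gen {a} {b} ab f≈) with source-a₀ a b ab
  ... | refl = (λ y y≢a → trans (f≈ y) (arcT-fix y y≢a))
             , (λ x e → arcT-hit-≢ x (arc-irreflexive D ab) (trans (sym (f≈ x)) e))
  generated-fixes-and-avoids (mul {f} {g} Sf Sg h≈)
    with generated-fixes-and-avoids Sf | generated-fixes-and-avoids Sg
  ... | f-fix , f-avoid | g-fix , g-avoid =
      (λ y y≢a → trans (h≈ y) (trans (cong g (f-fix y y≢a)) (g-fix y y≢a)))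
    , (λ x e → g-avoid (f x) (trans (sym (h≈ x)) e))

  left-zero : IsLeftZero D
  left-zero f g Sf Sg x =
    proj₁ (generated-fixes-and-avoids Sg) (f x) (proj₂ (generated-fixes-and-avoids Sf) x)

-- On two points every element of ⟨D⟩ is constant (generators are, since a ≠ b).
two-points-constant : ∀ {f} (D : Digraph 2) → InGen D f → f zero ≡ f (suc zero)
two-points-constant D (gen {zero}     {zero}     ab f≈) = ⊥-elim (arc-irreflexive D ab refl)
two-points-constant D (gen {zero}     {suc zero} ab f≈) = trans (f≈ zero) (sym (f≈ (suc zero)))
two-points-constant D (gen {suc zero} {zero}     ab f≈) = trans (f≈ zero) (sym (f≈ (suc zero)))
two-points-constant D (gen {suc zero} {suc zero} ab f≈) = ⊥-elim (arc-irreflexive D ab refl)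
two-points-constant D (mul {g = g} Sf Sg h≈) =
  trans (h≈ zero) (trans (cong g (two-points-constant D Sf)) (sym (h≈ (suc zero))))

two-points-right-zero : (D : Digraph 2) → IsRightZero D
two-points-right-zero D f g Sf Sg x = constant (f x) x
  where
  constant : ∀ x y → g x ≡ g y
  constant zero       zero       = refl
  constant zero       (suc zero) = two-points-constant D Sg
  constant (suc zero) zero       = sym (two-points-constant D Sg)
  constant (suc zero) (suc zero) = refl

zero-semigroup⇒rectangular : ∀ {n} (D : Digraph n) →
  IsLeftZero D ⊎ IsRightZero D → IsRectangularBand D
zero-semigroup⇒rectangular D (inj₁ lz) =
    (λ f Sf → lz f f Sf Sf)
  , (λ f g Sf Sg x → trans (cong f (lz f g Sf Sg x)) (lz f f Sf Sf x))
zero-semigroup⇒rectangular D (inj₂ rz) =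
    (λ f Sf → rz f f Sf Sf)
  , (λ f g Sf Sg x → trans (rz g f Sg Sf (f x)) (rz f f Sf Sf x))

-- A nonempty rectangular band is simple: f = f g f and g = g f g.
rectangular⇒simple : ∀ {n} (D : Digraph n) → Σ (Trans n) (InGen D) →
  IsRectangularBand D → IsSimple D
rectangular⇒simple D nonempty (_ , fgf≈f) =
  nonempty ,
  λ f g Sf Sg → (f , f , inj₁ Sf , inj₁ Sf , λ x → sym (fgf≈f f g Sf Sg x))
              , (g , g , inj₁ Sg , inj₁ Sg , λ x → sym (fgf≈f g f Sg Sf x))

-- On ≥ 3 points: pick an arc (a₀,b₀); any arc with another source would
-- form a 2-cycle with it, so D is an out-star at a₀.
simple⇒left-zero : ∀ {k} (D : Digraph (suc (suc (suc k)))) → Connected D →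
  IsSimple D → IsLeftZero D
simple⇒left-zero D conn S with connected-has-arc D conn {zero} {suc zero} (λ ())
... | a₀ , b₀ , a₀b₀ with sources-at-or-elsewhere D a₀
...   | inj₁ source-a₀ = OutStar.left-zero D a₀ source-a₀
...   | inj₂ (c , d , cd , c≢a₀) with simple-two-cycle D S a₀b₀ cd (λ e → c≢a₀ (sym e))
...     | refl , refl = ⊥-elim (simple-no-two-cycle D conn S a₀b₀ cd)

simple⇒zero-semigroup : ∀ {m} (D : Digraph (suc (suc m))) → Connected D →
  IsSimple D → IsLeftZero D ⊎ IsRightZero D
simple⇒zero-semigroup {zero}  D conn S = inj₂ (two-points-right-zero D)
simple⇒zero-semigroup {suc _}   D conn S = inj₁ (simple⇒left-zero D conn S)

proposition6p6 : (n : ℕ) → n ≥ 2 → (D : Digraph n) → Connected D →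
    (IsRectangularBand D ⇔ IsSimple D) × (IsSimple D ⇔ (IsLeftZero D ⊎ IsRightZero D))
proposition6p6 (suc (suc m)) (s≤s (s≤s z≤n)) D conn =
  mk⇔ rectangular⇒simple′ (λ S → zero-semigroup⇒rectangular D (simple⇒zero-semigroup D conn S)) ,
  mk⇔ (simple⇒zero-semigroup D conn) (λ z → rectangular⇒simple′ (zero-semigroup⇒rectangular D z))
  where
  nonempty : Σ (Trans (suc (suc m))) (InGen D)
  nonempty with connected-has-arc D conn {zero} {suc zero} (λ ())
  ... | a , b , ab = arcT a b , gen ab (λ _ → refl)

  rectangular⇒simple′ : IsRectangularBand D → IsSimple D
  rectangular⇒simple′ = rectangular⇒simple D nonempty
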